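{- Let $G$ be a connected graph of order $n\geq 5$. Then $sdiam_{n-3}(G)=n-4$ if and only if $\kappa(G)\geq 4$, and $sdiam_{n-3}(G)=n-1$ if and only if $G$ contains at least $3$ cut vertices.
   Context: $\kappa(G)$ denotes the vertex connectivity of $G$ (with $\kappa(K_n)=n-1$). For $S\subseteq V(G)$, the Steiner distance $d_G(S)$ is the minimum number of edges of a connected subgraph of $G$ whose vertex set contains $S$. For $2\leq m\leq n$, the Steiner $m$-diameter is $sdiam_m(G)=\max\{d_G(S): S\subseteq V(G),\ |S|=m\}$. A cut vertex is a vertex whose removal disconnects $G$. -}

module Defs where

open import Data.Nat using (ℕ; _≤_; _∸_; _<ᵇ_)
open import Data.Bool using (Bool; true; false; _∧_; not; T)
open import Data.Fin using (Fin; toℕ)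
open import Data.Fin.Subset using (Subset; _∈_; _∉_; ∣_∣; _⊆_)
open import Data.List using (List; length; filterᵇ; cartesianProduct; allFin)
open import Data.Product using (Σ; ∃; ∃-syntax; _×_; _,_; proj₁; proj₂)
open import Data.Sum using (_⊎_)
open import Data.Vec using (lookup)
open import Relation.Binary.PropositionalEquality using (_≡_; _≢_)
open import Relation.Nullary using (¬_)

record Graph (n : ℕ) : Set where
  field
    adj    : Fin n → Fin n → Bool
    sym    : ∀ u v → adj u v ≡ adj v u
    irrefl : ∀ v → adj v v ≡ false
open Graph public

data Reach {n : ℕ} (E : Fin n → Fin n → Bool) : Fin n → Fin n → Set where
  here : ∀ {u} → Reach E u u
  step : ∀ {u w v} → T (E u w) → Reach E w v → Reach E u v

Connected : ∀ {n} → Graph n → Set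
Connected {n} G = ∀ (u v : Fin n) → Reach (adj G) u v

delAdj : ∀ {n} → Graph n → Subset n → Fin n → Fin n → Bool
delAdj G S u v = adj G u v ∧ not (lookup S u) ∧ not (lookup S v)

Separating : ∀ {n} → Graph n → Subset n → Set
Separating G S = ∃[ u ] ∃[ v ] (u ∉ S × v ∉ S × ¬ Reach (delAdj G S) u v)

Complete : ∀ {n} → Graph n → Set
Complete {n} G = ∀ (u v : Fin n) → u ≢ v → T (adj G u v)

VertexConn : ∀ {n} → Graph n → ℕ → Set
VertexConn {n} G k =
  (Complete G × k ≡ n ∸ 1)
  ⊎ (¬ Complete G × (∃[ S ] (Separating G S × ∣ S ∣ ≡ k))
       × (∀ S → Separating G S → k ≤ ∣ S ∣))

CutVertex : ∀ {n} → Graph n → Fin n → Set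
CutVertex {n} G v = ∃[ a ] ∃[ b ] (a ≢ v × b ≢ v × ¬ Reach (delAdj G (Data.Fin.Subset.⁅ v ⁆)) a b)

edgeCount : ∀ {n} → (Fin n → Fin n → Bool) → ℕ
edgeCount {n} E =
  length (filterᵇ (λ p → (toℕ (proj₁ p) <ᵇ toℕ (proj₂ p)) ∧ E (proj₁ p) (proj₂ p))
                  (cartesianProduct (allFin n) (allFin n)))

record SteinerSubgraph {n} (G : Graph n) (S : Subset n) (k : ℕ) : Set where
  field
    U       : Subset n
    E       : Fin n → Fin n → Bool
    E-sym   : ∀ u v → E u v ≡ E v u
    E-sub   : ∀ u v → T (E u v) → T (adj G u v)
    E-ends  : ∀ u v → T (E u v) → u ∈ U
    S⊆U     : S ⊆ U
    conn    : ∀ u v → u ∈ U → v ∈ U → Reach E u v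
    size    : edgeCount E ≡ k

SteinerDist : ∀ {n} → Graph n → Subset n → ℕ → Set
SteinerDist G S d = SteinerSubgraph G S d × (∀ k → SteinerSubgraph G S k → d ≤ k)

SDiam : ∀ {n} → Graph n → ℕ → ℕ → Set
SDiam G m D =
  (∃[ S ] (∣ S ∣ ≡ m × SteinerDist G S D))
  × (∀ S → ∣ S ∣ ≡ m → ∀ d → SteinerDist G S d → d ≤ D)

KappaAtLeast : ∀ {n} → Graph n → ℕ → Set
KappaAtLeast G k = ∃[ c ] (VertexConn G c × k ≤ c)

AtLeast3CutVertices : ∀ {n} → Graph n → Set
AtLeast3CutVertices G = ∃[ a ] ∃[ b ] ∃[ c ]
  (a ≢ b × a ≢ c × b ≢ c × CutVertex G a × CutVertex G b × CutVertex G c)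

-- Write a set of n − 3 vertices as S = V ∖ X with |X| = 3. A connected subgraph containing S
-- has at least |S| − 1 = n − 4 edges, with equality exactly when its vertex set is S, which
-- is possible iff G − X is connected. So sdiam_{n−3} = n − 4 iff no three vertices separate G,
-- and since n ≥ 5 a smaller separator can be padded to three vertices avoiding the two vertices
-- it separates, this means κ ≥ 4.
-- Always sdiam_{n−3} ≤ n − 1, with equality iff some S = V ∖ {x, y, z} admits no connected
-- subgraph avoiding one of x, y, z. If, say, x is not a cut vertex, a spanning tree of G − x
-- is such a subgraph. Conversely, if x, y, z are cut vertices and a connected subgraph containing
-- S misses x, then all of V ∖ {x, y, z} lies in one component of G − x; one of y, z lies outside
-- it, and its neighbourhood is then too small for both y and z to be cut vertices.
-- Edge counts are controlled through spanning trees: a connected graph on k vertices contains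
-- a connected spanning subgraph with exactly k − 1 edges (delete an edge; if it is a bridge,
-- recurse into both sides and reconnect).

module Submission where

open import Defs renaming (sym to adj-sym)
open import Data.Nat using (ℕ; zero; suc; _+_; _*_; _∸_; _≤_; _<_; z≤n; s≤s; _<ᵇ_; _≡ᵇ_; _≤?_)
import Data.Nat.Properties as ℕ
open import Data.Bool using (Bool; true; false; _∧_; _∨_; not; T)
open import Data.Bool.Properties using (T?; T-≡; ∧-distribˡ-∨; ∨-comm; not-involutive)
open import Data.Fin using (Fin; toℕ; zero; suc; fromℕ<) renaming (_≟_ to _≟ᶠ_)
open import Data.Fin.Properties using (any?; toℕ-injective; suc-injective; <⇒≢)
open import Data.Fin.Subset using (Subset; inside; outside; _∈_; _∉_; ∣_∣; _⊆_; _-_; ⁅_⁆; ∁; ⊤)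
open import Data.Fin.Subset.Properties
  using ( _∈?_; nonempty?; anySubset?; Empty-unique; ∣⊥∣≡0; ∣⊤∣≡n; ∈⊤; ∣⁅x⁆∣≡1; x∈⁅y⁆⇒x≡y
        ; x≢y⇒x∉⁅y⁆; x∉⁅y⁆⇒x≢y; p⊆q⇒∣p∣≤∣q∣; x∈p⇒∣p-x∣<∣p∣; x∈p∧x≢y⇒x∈p-y; p─q⊆p; p─⊥≡p
        ; ∣∁p∣≡n∸∣p∣; x∈p⇒x∉∁p; x∈∁p⇒x∉p; x∉p⇒x∈∁p; x∉∁p⇒x∈p)
open import Data.List using (List; []; _∷_; _++_; length; map; filterᵇ; cartesianProduct; allFin)
open import Data.List.Properties using (map-tabulate)
open import Data.Vec using (lookup; tabulate; _∷_; [])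
open import Data.Vec.Properties using ([]=⇒lookup; lookup⇒[]=; lookup∘tabulate)
open import Data.Vec.Base using (here; there)
open import Data.Product using (∃-syntax; _×_; _,_; proj₁; proj₂)
open import Data.Sum using (_⊎_; inj₁; inj₂; [_,_])
open import Data.Empty using (⊥; ⊥-elim)
open import Data.Unit using (tt)
open import Function using (_∘_)
open import Function.Bundles using (Equivalence; mk⇔; _⇔_)
open import Relation.Binary.Definitions using (tri<; tri≈; tri>)
open import Relation.Binary.PropositionalEquality
  using (_≡_; _≢_; refl; sym; trans; cong; cong₂; subst; module ≡-Reasoning)
open import Relation.Nullary using (¬_; Dec; yes; no; ¬?)
open import Relation.Nullary.Decidable
  using (_×-dec_; isYes; toWitness; fromWitness; toWitnessFalse; fromWitnessFalse; decidable-stable)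

T-∧ˡ : ∀ {a b} → T (a ∧ b) → T a
T-∧ˡ {true} _ = tt

T-∧ʳ : ∀ {a b} → T (a ∧ b) → T b
T-∧ʳ {true} t = t

T-∧⁺ : ∀ {a b} → T a → T b → T (a ∧ b)
T-∧⁺ {true} {true} _ _ = tt

T-∨ˡ : ∀ {a b} → T a → T (a ∨ b)
T-∨ˡ {true} _ = tt

T-∨ʳ : ∀ {a b} → T b → T (a ∨ b)
T-∨ʳ {true} _ = tt
T-∨ʳ {false} t = t

T-∨⁻ : ∀ {a b} → T (a ∨ b) → T a ⊎ T b
T-∨⁻ {true} t = inj₁ tt
T-∨⁻ {false} t = inj₂ t

T-ext : ∀ {a b} → (T a → T b) → (T b → T a) → a ≡ b
T-ext {true} {true} _ _ = refl
T-ext {true} {false} f _ = ⊥-elim (f tt)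
T-ext {false} {true} _ g = ⊥-elim (g tt)
T-ext {false} {false} _ _ = refl

T-not-T : ∀ {x} → T (not x) → T x → ⊥
T-not-T {true} () _

∨-absorbs-∧-not : ∀ {x y} → (T y → T x) → x ≡ (x ∧ not y) ∨ y
∨-absorbs-∧-not {true} {true} _ = refl
∨-absorbs-∧-not {true} {false} _ = refl
∨-absorbs-∧-not {false} {true} y⇒x = ⊥-elim (y⇒x tt)
∨-absorbs-∧-not {false} {false} _ = refl

_==_ : ∀ {n} → Fin n → Fin n → Bool
u == v = toℕ u ≡ᵇ toℕ v

==⇒≡ : ∀ {n} {u v : Fin n} → T (u == v) → u ≡ v
==⇒≡ {u = u} {v} t = toℕ-injective (ℕ.≡ᵇ⇒≡ (toℕ u) (toℕ v) t)

==-refl : ∀ {n} (u : Fin n) → T (u == u)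
==-refl u = ℕ.≡⇒≡ᵇ (toℕ u) (toℕ u) refl

∈⇒T : ∀ {n} {x : Fin n} {p : Subset n} → x ∈ p → T (lookup p x)
∈⇒T x∈p = Equivalence.from T-≡ ([]=⇒lookup x∈p)

T⇒∈ : ∀ {n} {x : Fin n} {p : Subset n} → T (lookup p x) → x ∈ p
T⇒∈ {x = x} {p} t = lookup⇒[]= x p (Equivalence.to T-≡ t)

∉⇒T-not : ∀ {n} {x : Fin n} {p : Subset n} → x ∉ p → T (not (lookup p x))
∉⇒T-not {x = x} {p} x∉p with lookup p x in eq
... | true = x∉p (T⇒∈ (subst T (sym eq) tt))
... | false = tt

T-not⇒∉ : ∀ {n} {x : Fin n} {p : Subset n} → T (not (lookup p x)) → x ∉ p
T-not⇒∉ {x = x} {p} t x∈p with lookup p x | ∈⇒T x∈p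
T-not⇒∉ () x∈p | true | _

x∉p-x : ∀ {n} (p : Subset n) x → x ∉ p - x
x∉p-x (inside ∷ p) zero ()
x∉p-x (outside ∷ p) zero ()
x∉p-x (s ∷ p) (suc x) (there h) = x∉p-x p x h

_∩ᵇ_ : ∀ {n} → Subset n → (Fin n → Bool) → Subset n
U ∩ᵇ p = tabulate (λ x → lookup U x ∧ p x)

∈-∩ᵇ⁺ : ∀ {n} {U : Subset n} {p x} → x ∈ U → T (p x) → x ∈ U ∩ᵇ p
∈-∩ᵇ⁺ {U = U} {p} {x} x∈U px =
  T⇒∈ (subst T (sym (lookup∘tabulate (λ x → lookup U x ∧ p x) x)) (T-∧⁺ (∈⇒T x∈U) px))

∈-∩ᵇ⁻ : ∀ {n} {U : Subset n} {p x} → x ∈ U ∩ᵇ p → x ∈ U × T (p x)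
∈-∩ᵇ⁻ {U = U} {p} {x} x∈ =
  let t = subst T (lookup∘tabulate (λ x → lookup U x ∧ p x) x) (∈⇒T x∈)
  in T⇒∈ (T-∧ˡ {lookup U x} t) , T-∧ʳ {lookup U x} t

∣∩ᵇ∣+∣∩ᵇnot∣ : ∀ {n} (U : Subset n) (p : Fin n → Bool) → ∣ U ∣ ≡ ∣ U ∩ᵇ p ∣ + ∣ U ∩ᵇ (not ∘ p) ∣
∣∩ᵇ∣+∣∩ᵇnot∣ [] p = refl
∣∩ᵇ∣+∣∩ᵇnot∣ (s ∷ U) p with ∣∩ᵇ∣+∣∩ᵇnot∣ U (p ∘ suc) | s | p zero
... | ih | true | true = cong suc ih
... | ih | true | false = trans (cong suc ih) (sym (ℕ.+-suc _ _))
... | ih | false | _ = ih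

∣p∣≡0 : ∀ {n} (p : Subset n) → (∀ x → x ∉ p) → ∣ p ∣ ≡ 0
∣p∣≡0 {n} p empty = trans (cong ∣_∣ (Empty-unique (λ (x , x∈p) → empty x x∈p))) (∣⊥∣≡0 n)

∣p∣≤1 : ∀ {n} (p : Subset n) → (∀ x y → x ∈ p → y ∈ p → x ≡ y) → ∣ p ∣ ≤ 1
∣p∣≤1 [] _ = z≤n
∣p∣≤1 (inside ∷ p) unique =
  ℕ.≤-reflexive (cong suc (∣p∣≡0 p (λ x x∈p → zero≢suc (unique zero (suc x) here (there x∈p)))))
  where
    zero≢suc : ∀ {n} {x : Fin n} → zero ≢ suc x
    zero≢suc ()
∣p∣≤1 (outside ∷ p) unique =
  ∣p∣≤1 p (λ x y x∈p y∈p → suc-injective (unique (suc x) (suc y) (there x∈p) (there y∈p)))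

x∈p⇒1≤∣p∣ : ∀ {n} {p : Subset n} {x} → x ∈ p → 1 ≤ ∣ p ∣
x∈p⇒1≤∣p∣ {p = p} {x} x∈p =
  subst (_≤ ∣ p ∣) (∣⁅x⁆∣≡1 x) (p⊆q⇒∣p∣≤∣q∣ (λ y∈⁅x⁆ → subst (_∈ p) (sym (x∈⁅y⁆⇒x≡y x y∈⁅x⁆)) x∈p))

x∈p-y⇒x∈p∧x≢y : ∀ {n} {p : Subset n} {x y} → y ∈ p - x → y ∈ p × y ≢ x
x∈p-y⇒x∈p∧x≢y {p = p} {x} {y} y∈p-x = p─q⊆p p ⁅ x ⁆ y∈p-x , λ { refl → x∉p-x p y y∈p-x }

∣p∣≡1+∣p-x∣ : ∀ {n} (p : Subset n) {x} → x ∈ p → ∣ p ∣ ≡ suc ∣ p - x ∣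
∣p∣≡1+∣p-x∣ (inside ∷ p) {zero} here = cong (suc ∘ ∣_∣) (sym (p─⊥≡p p))
∣p∣≡1+∣p-x∣ (inside ∷ p) {suc x} (there x∈p) = cong suc (∣p∣≡1+∣p-x∣ p x∈p)
∣p∣≡1+∣p-x∣ (outside ∷ p) {suc x} (there x∈p) = ∣p∣≡1+∣p-x∣ p x∈p

element : ∀ {n} (p : Subset n) {k} → ∣ p ∣ ≡ suc k → ∃[ x ] x ∈ p
element {n} p ∣p∣≡1+k with nonempty? p
... | yes x∈p = x∈p
... | no empty = ⊥-elim (ℕ.0≢1+n (trans (sym (∣p∣≡0 p (λ x x∈p → empty (x , x∈p)))) ∣p∣≡1+k))

three-elements : ∀ {n} (p : Subset n) → ∣ p ∣ ≡ 3 →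
  ∃[ x ] ∃[ y ] ∃[ z ] (x ≢ y × x ≢ z × y ≢ z × x ∈ p × y ∈ p × z ∈ p)
three-elements p ∣p∣≡3 with element p ∣p∣≡3
... | x , x∈p with element (p - x) (ℕ.suc-injective (trans (sym (∣p∣≡1+∣p-x∣ p x∈p)) ∣p∣≡3))
... | y , y∈p-x with element (p - x - y) (ℕ.suc-injective (ℕ.suc-injective
                       (trans (sym (trans (∣p∣≡1+∣p-x∣ p x∈p) (cong suc (∣p∣≡1+∣p-x∣ (p - x) y∈p-x)))) ∣p∣≡3)))
... | z , z∈p-x-y =
  let (y∈p , y≢x) = x∈p-y⇒x∈p∧x≢y y∈p-x
      (z∈p-x , z≢y) = x∈p-y⇒x∈p∧x≢y z∈p-x-y
      (z∈p , z≢x) = x∈p-y⇒x∈p∧x≢y z∈p-x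
  in x , y , z , y≢x ∘ sym , z≢x ∘ sym , z≢y ∘ sym , x∈p , y∈p , z∈p

∣⊤-x-y∣ : ∀ {n} {x y : Fin n} → x ≢ y → suc (suc ∣ ⊤ - x - y ∣) ≡ n
∣⊤-x-y∣ {n} {x} {y} x≢y = sym (begin
  n                         ≡⟨ sym (∣⊤∣≡n n) ⟩
  ∣ ⊤ {n} ∣                 ≡⟨ ∣p∣≡1+∣p-x∣ ⊤ {x} ∈⊤ ⟩
  suc ∣ ⊤ - x ∣             ≡⟨ cong suc (∣p∣≡1+∣p-x∣ (⊤ - x) (x∈p∧x≢y⇒x∈p-y ∈⊤ (x≢y ∘ sym))) ⟩
  suc (suc ∣ ⊤ - x - y ∣)   ∎)
  where open ≡-Reasoning

∣⊤-x-y-z∣ : ∀ {n} {x y z : Fin n} → x ≢ y → x ≢ z → y ≢ z → suc (suc (suc ∣ ⊤ - x - y - z ∣)) ≡ n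
∣⊤-x-y-z∣ {x = x} {y} {z} x≢y x≢z y≢z =
  trans (cong (λ k → suc (suc k)) (sym (∣p∣≡1+∣p-x∣ (⊤ - x - y) z∈⊤-x-y))) (∣⊤-x-y∣ x≢y)
  where
    z∈⊤-x-y : z ∈ ⊤ - x - y
    z∈⊤-x-y = x∈p∧x≢y⇒x∈p-y (x∈p∧x≢y⇒x∈p-y ∈⊤ (x≢z ∘ sym)) (y≢z ∘ sym)

∈⊤-x-y-z : ∀ {n} {x y z w : Fin n} → w ≢ x → w ≢ y → w ≢ z → w ∈ ⊤ - x - y - z
∈⊤-x-y-z w≢x w≢y w≢z = x∈p∧x≢y⇒x∈p-y (x∈p∧x≢y⇒x∈p-y (x∈p∧x≢y⇒x∈p-y ∈⊤ w≢x) w≢y) w≢z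

shrink : ∀ j {n} {S Y : Subset n} {k} → S ⊆ Y → ∣ S ∣ ≤ k → ∣ Y ∣ ≡ k + j →
  ∃[ X ] (S ⊆ X × X ⊆ Y × ∣ X ∣ ≡ k)
shrink zero {Y = Y} {k} S⊆Y _ ∣Y∣≡k = Y , S⊆Y , (λ y∈Y → y∈Y) , trans ∣Y∣≡k (ℕ.+-identityʳ k)
shrink (suc j) {S = S} {Y} {k} S⊆Y ∣S∣≤k ∣Y∣≡k+1+j with any? (λ y → y ∈? Y ×-dec ¬? (y ∈? S))
... | yes (y , y∈Y , y∉S) =
  let (X , S⊆X , X⊆Y-y , ∣X∣≡k) = shrink j S⊆Y-y ∣S∣≤k ∣Y-y∣≡k+j
  in X , S⊆X , p─q⊆p Y ⁅ y ⁆ ∘ X⊆Y-y , ∣X∣≡k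
  where
    S⊆Y-y : S ⊆ Y - y
    S⊆Y-y {s} s∈S = x∈p∧x≢y⇒x∈p-y (S⊆Y s∈S) (λ { refl → y∉S s∈S })
    ∣Y-y∣≡k+j : ∣ Y - y ∣ ≡ k + j
    ∣Y-y∣≡k+j = ℕ.suc-injective (trans (sym (∣p∣≡1+∣p-x∣ Y y∈Y)) (trans ∣Y∣≡k+1+j (ℕ.+-suc k j)))
... | no none = ⊥-elim (ℕ.<-irrefl refl (begin-strict
  ∣ Y ∣        ≤⟨ p⊆q⇒∣p∣≤∣q∣ Y⊆S ⟩
  ∣ S ∣        ≤⟨ ∣S∣≤k ⟩
  k            <⟨ ℕ.m<m+n k (s≤s z≤n) ⟩
  k + suc j    ≡⟨ sym ∣Y∣≡k+1+j ⟩
  ∣ Y ∣        ∎))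
  where
    open ℕ.≤-Reasoning
    Y⊆S : Y ⊆ S
    Y⊆S {y} y∈Y with y ∈? S
    ... | yes y∈S = y∈S
    ... | no y∉S = ⊥-elim (none (y , y∈Y , y∉S))

∁-involutive : ∀ {n} (p : Subset n) → ∁ (∁ p) ≡ p
∁-involutive [] = refl
∁-involutive (s ∷ p) = cong₂ _∷_ (not-involutive s) (∁-involutive p)

p⊆q∧∣q∣≤∣p∣⇒q⊆p : ∀ {n} {S U : Subset n} → S ⊆ U → ∣ U ∣ ≤ ∣ S ∣ → U ⊆ S
p⊆q∧∣q∣≤∣p∣⇒q⊆p {S = S} {U} S⊆U ∣U∣≤∣S∣ {w} w∈U with w ∈? S
... | yes w∈S = w∈S
... | no w∉S = ⊥-elim (ℕ.<-irrefl refl (begin-strict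
  ∣ S ∣       ≤⟨ p⊆q⇒∣p∣≤∣q∣ S⊆U-w ⟩
  ∣ U - w ∣   <⟨ x∈p⇒∣p-x∣<∣p∣ w∈U ⟩
  ∣ U ∣       ≤⟨ ∣U∣≤∣S∣ ⟩
  ∣ S ∣       ∎))
  where
    open ℕ.≤-Reasoning
    S⊆U-w : S ⊆ U - w
    S⊆U-w {s} s∈S = x∈p∧x≢y⇒x∈p-y (S⊆U s∈S) (λ { refl → w∉S s∈S })

Least : (ℕ → Set) → ℕ → Set
Least P c = P c × (∀ j → P j → c ≤ j)

least : (P : ℕ → Set) → (∀ j → Dec (P j)) → ∀ {k} → P k → ∃[ c ] Least P c
least P P? {zero} p0 = 0 , p0 , λ _ _ → z≤n
least P P? {suc k} pk with P? 0 | least (P ∘ suc) (P? ∘ suc) pk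
... | yes p0 | _ = 0 , p0 , λ _ _ → z≤n
... | no ¬p0 | c , pc , c≤ = suc c , pc , λ { zero p0 → ⊥-elim (¬p0 p0) ; (suc j) pj → s≤s (c≤ j pj) }

¬¬-least : (P : ℕ → Set) → ∀ {k} → P k → ¬ ¬ (∃[ c ] Least P c)
¬¬-least P {zero} p0 no-least = no-least (0 , p0 , λ _ _ → z≤n)
¬¬-least P {suc k} pk no-least = ¬¬-least (P ∘ suc) pk λ (c , pc , c≤) →
  no-least (suc c , pc , λ { zero p0 → ⊥-elim (no-least (0 , p0 , λ _ _ → z≤n)) ; (suc j) pj → s≤s (c≤ j pj) })

Rel : ℕ → Set
Rel n = Fin n → Fin n → Bool

_⊆ᵣ_ : ∀ {n} → Rel n → Rel n → Set
E ⊆ᵣ F = ∀ u v → T (E u v) → T (F u v)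

Symmetric : ∀ {n} → Rel n → Set
Symmetric E = ∀ u v → E u v ≡ E v u

reach-trans : ∀ {n} {E : Rel n} {u v w} → Reach E u v → Reach E v w → Reach E u w
reach-trans here q = q
reach-trans (step e p) q = step e (reach-trans p q)

reach-snoc : ∀ {n} {E : Rel n} {u v w} → Reach E u v → T (E v w) → Reach E u w
reach-snoc p e = reach-trans p (step e here)

reach-sym : ∀ {n} {E : Rel n} → Symmetric E → ∀ {u v} → Reach E u v → Reach E v u
reach-sym E-sym here = here
reach-sym E-sym {u} (step {w = w} e p) = reach-snoc (reach-sym E-sym p) (subst T (E-sym u w) e)

reach-mono : ∀ {n} {E F : Rel n} → E ⊆ᵣ F → ∀ {u v} → Reach E u v → Reach F u v
reach-mono E⊆F here = here
reach-mono E⊆F (step e p) = step (E⊆F _ _ e) (reach-mono E⊆F p)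

reach-within : ∀ {n} {E F : Rel n} (P : Fin n → Set) →
  (∀ x y → P x → T (E x y) → P y × T (F x y)) → ∀ {u v} → P u → Reach E u v → Reach F u v
reach-within P closed pu here = here
reach-within P closed pu (step e p) =
  step (proj₂ (closed _ _ pu e)) (reach-within P closed (proj₁ (closed _ _ pu e)) p)

reach-loops : ∀ {n} {E : Rel n} → (∀ u v → T (E u v) → u ≡ v) → ∀ {u v} → Reach E u v → u ≡ v
reach-loops loops here = refl
reach-loops loops (step e p) = trans (loops _ _ e) (reach-loops loops p)

opaque
  restrict : ∀ {n} → Rel n → Subset n → Rel n
  restrict E A x y = E x y ∧ lookup A x ∧ lookup A y

  restrict-⊆ : ∀ {n} {E : Rel n} {A} → restrict E A ⊆ᵣ E
  restrict-⊆ x y e = T-∧ˡ e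

  restrict-∈ˡ : ∀ {n} {E : Rel n} {A x y} → T (restrict E A x y) → x ∈ A
  restrict-∈ˡ {E = E} {A} {x} {y} e = T⇒∈ (T-∧ˡ {lookup A x} (T-∧ʳ {E x y} e))

  restrict-∈ʳ : ∀ {n} {E : Rel n} {A x y} → T (restrict E A x y) → y ∈ A
  restrict-∈ʳ {E = E} {A} {x} {y} e = T⇒∈ (T-∧ʳ {lookup A x} (T-∧ʳ {E x y} e))

  restrict⁺ : ∀ {n} {E : Rel n} {A x y} → T (E x y) → x ∈ A → y ∈ A → T (restrict E A x y)
  restrict⁺ e x∈A y∈A = T-∧⁺ e (T-∧⁺ (∈⇒T x∈A) (∈⇒T y∈A))

restrict-sym : ∀ {n} {E : Rel n} {A} → Symmetric E → Symmetric (restrict E A)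
restrict-sym {E = E} {A} E-sym u v = T-ext (flip u v) (flip v u)
  where
    flip : ∀ u v → T (restrict E A u v) → T (restrict E A v u)
    flip u v e = restrict⁺ (subst T (E-sym u v) (restrict-⊆ u v e)) (restrict-∈ʳ e) (restrict-∈ˡ e)

restrict-mono : ∀ {n} {E : Rel n} {A B} → B ⊆ A → restrict E B ⊆ᵣ restrict E A
restrict-mono B⊆A x y e = restrict⁺ (restrict-⊆ x y e) (B⊆A (restrict-∈ˡ e)) (B⊆A (restrict-∈ʳ e))

reach-restrict-∉ : ∀ {n} {E : Rel n} {A u v} → Reach (restrict E A) u v → u ∉ A → u ≡ v
reach-restrict-∉ here _ = refl
reach-restrict-∉ (step e p) u∉A = ⊥-elim (u∉A (restrict-∈ˡ e))

module _ {n} (E : Rel n) where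

  private
    ∈-minus-start : ∀ {A u y v} → y ∈ A → Reach (restrict E (A - u)) y v → v ≢ u → y ∈ A - u
    ∈-minus-start {A} {u} {y} y∈A p v≢u with y ≟ᶠ u
    ... | yes refl = ⊥-elim (v≢u (sym (reach-restrict-∉ p (x∉p-x A u))))
    ... | no y≢u = x∈p∧x≢y⇒x∈p-y y∈A y≢u

  reach-restrict-last : ∀ {A u x v} → Reach (restrict E A) x v → v ≢ u →
    Reach (restrict E (A - u)) x v
      ⊎ ∃[ w ] (T (E u w) × w ∈ A - u × Reach (restrict E (A - u)) w v)
  reach-restrict-last here _ = inj₁ here
  reach-restrict-last {A} {u} {x} (step {w = y} e p) v≢u with reach-restrict-last p v≢u
  ... | inj₂ r = inj₂ r
  ... | inj₁ q with x ≟ᶠ u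
  ...   | yes refl = inj₂ (y , restrict-⊆ x y e , ∈-minus-start (restrict-∈ʳ e) q v≢u , q)
  ...   | no x≢u = inj₁ (step e′ q)
    where
      e′ : T (restrict E (A - u) x y)
      e′ = restrict⁺ (restrict-⊆ x y e) (x∈p∧x≢y⇒x∈p-y (restrict-∈ˡ e) x≢u)
                     (∈-minus-start (restrict-∈ʳ e) q v≢u)

  reach-restrict? : ∀ (A : Subset n) u v → Dec (Reach (restrict E A) u v)
  reach-restrict? A = search (suc ∣ A ∣) A ℕ.≤-refl
    where
      search : ∀ k (A : Subset n) → ∣ A ∣ < k → ∀ u v → Dec (Reach (restrict E A) u v)
      search (suc k) A (s≤s ∣A∣≤k) u v with u ≟ᶠ v
      ... | yes refl = yes here
      ... | no u≢v with u ∈? A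
      ...   | no u∉A = no (λ p → u≢v (reach-restrict-∉ p u∉A))
      ...   | yes u∈A with any? (λ w → T? (E u w) ×-dec w ∈? A - u ×-dec
                                       search k (A - u) (ℕ.<-≤-trans (x∈p⇒∣p-x∣<∣p∣ u∈A) ∣A∣≤k) w v)
      ...     | yes (w , e , w∈A-u , p) =
                  yes (step (restrict⁺ e u∈A (p─q⊆p A ⁅ u ⁆ w∈A-u)) (reach-mono (restrict-mono (p─q⊆p A ⁅ u ⁆)) p))
      ...     | no none = no (λ p → via-u (reach-restrict-last p (u≢v ∘ sym)))
        where
          via-u : ¬ (Reach (restrict E (A - u)) u v
                      ⊎ ∃[ w ] (T (E u w) × w ∈ A - u × Reach (restrict E (A - u)) w v))
          via-u (inj₁ q) = u≢v (reach-restrict-∉ q (x∉p-x A u))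
          via-u (inj₂ found) = none found

count : ∀ {A : Set} → (A → Bool) → List A → ℕ
count p xs = length (filterᵇ p xs)

count-cong : ∀ {A : Set} {p q : A → Bool} → (∀ x → p x ≡ q x) → ∀ xs → count p xs ≡ count q xs
count-cong p≗q [] = refl
count-cong {p = p} {q} p≗q (x ∷ xs) with p x | q x | p≗q x
... | true | .true | refl = cong suc (count-cong p≗q xs)
... | false | .false | refl = count-cong p≗q xs

count-∨ : ∀ {A : Set} {p q : A → Bool} → (∀ x → T (p x) → T (q x) → ⊥) → ∀ xs →
  count (λ x → p x ∨ q x) xs ≡ count p xs + count q xs
count-∨ disjoint [] = refl
count-∨ {p = p} {q} disjoint (x ∷ xs) with p x in px | q x in qx
... | true | true = ⊥-elim (disjoint x (subst T (sym px) tt) (subst T (sym qx) tt))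
... | true | false = cong suc (count-∨ disjoint xs)
... | false | true = trans (cong suc (count-∨ disjoint xs)) (sym (ℕ.+-suc _ _))
... | false | false = count-∨ disjoint xs

count-mono : ∀ {A : Set} {p q : A → Bool} → (∀ x → T (p x) → T (q x)) → ∀ xs → count p xs ≤ count q xs
count-mono p⇒q [] = z≤n
count-mono {p = p} {q} p⇒q (x ∷ xs) with p x in px | q x in qx
... | true | true = s≤s (count-mono p⇒q xs)
... | true | false = ⊥-elim (subst T qx (p⇒q x (subst T (sym px) tt)))
... | false | true = ℕ.m≤n⇒m≤1+n (count-mono p⇒q xs)
... | false | false = count-mono p⇒q xs

count≢0 : ∀ {A : Set} {p : A → Bool} xs {k} → count p xs ≡ suc k → ∃[ x ] T (p x)
count≢0 {p = p} (x ∷ xs) c≡1+k with p x in px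
... | true = x , subst T (sym px) tt
... | false = count≢0 xs c≡1+k

count-none : ∀ {A : Set} {p : A → Bool} → (∀ x → p x ≡ false) → ∀ xs → count p xs ≡ 0
count-none none [] = refl
count-none {p = p} none (x ∷ xs) with p x | none x
... | false | refl = count-none none xs

count-++ : ∀ {A : Set} (p : A → Bool) xs ys → count p (xs ++ ys) ≡ count p xs + count p ys
count-++ p [] ys = refl
count-++ p (x ∷ xs) ys with p x
... | true = cong suc (count-++ p xs ys)
... | false = count-++ p xs ys

count-map : ∀ {A B : Set} (p : B → Bool) (f : A → B) xs → count p (map f xs) ≡ count (p ∘ f) xs
count-map p f [] = refl
count-map p f (x ∷ xs) with p (f x)
... | true = cong suc (count-map p f xs)
... | false = count-map p f xs

count-× : ∀ {A B : Set} (p : A → Bool) (q : B → Bool) xs ys →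
  count (λ xy → p (proj₁ xy) ∧ q (proj₂ xy)) (cartesianProduct xs ys) ≡ count p xs * count q ys
count-× p q [] ys = refl
count-× {A} {B} p q (x ∷ xs) ys = begin
  count r (map (x ,_) ys ++ cartesianProduct xs ys)
    ≡⟨ count-++ r (map (x ,_) ys) (cartesianProduct xs ys) ⟩
  count r (map (x ,_) ys) + count r (cartesianProduct xs ys)
    ≡⟨ cong₂ _+_ (count-map r (x ,_) ys) (count-× p q xs ys) ⟩
  count (λ y → p x ∧ q y) ys + count p xs * count q ys
    ≡⟨ first-row ⟩
  count p (x ∷ xs) * count q ys ∎
  where
    open ≡-Reasoning
    r : A × B → Bool
    r xy = p (proj₁ xy) ∧ q (proj₂ xy)
    first-row : count (λ y → p x ∧ q y) ys + count p xs * count q ys ≡ count p (x ∷ xs) * count q ys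
    first-row with p x
    ... | true = refl
    ... | false = cong (_+ count p xs * count q ys) (count-none (λ _ → refl) ys)

allFin-suc : ∀ n → allFin (suc n) ≡ zero ∷ map suc (allFin n)
allFin-suc n = cong (zero ∷_) (sym (map-tabulate {n = n} (λ x → x) suc))

count-==-allFin : ∀ n (c : Fin n) → count (_== c) (allFin n) ≡ 1
count-==-allFin (suc n) c = trans (cong (count (_== c)) (allFin-suc n)) (split c)
  where
    open ≡-Reasoning
    split : ∀ c → count (_== c) (zero ∷ map suc (allFin n)) ≡ 1
    split zero = cong suc (begin
      count (_== zero) (map suc (allFin n))  ≡⟨ count-map (_== zero) suc (allFin n) ⟩
      count (λ x → suc x == zero) (allFin n) ≡⟨ count-none (λ _ → refl) (allFin n) ⟩
      0                                      ∎)
    split (suc c) = begin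
      count (_== suc c) (map suc (allFin n)) ≡⟨ count-map (_== suc c) suc (allFin n) ⟩
      count (_== c) (allFin n)               ≡⟨ count-==-allFin n c ⟩
      1                                      ∎

_<ᶠ_ : ∀ {n} → Fin n → Fin n → Bool
u <ᶠ v = toℕ u <ᵇ toℕ v

pairs : ∀ n → List (Fin n × Fin n)
pairs n = cartesianProduct (allFin n) (allFin n)

edgeCount-cong : ∀ {n} {E F : Rel n} → (∀ u v → E u v ≡ F u v) → edgeCount E ≡ edgeCount F
edgeCount-cong {n} E≗F = count-cong (λ (u , v) → cong (u <ᶠ v ∧_) (E≗F u v)) (pairs n)

edgeCount-∨ : ∀ {n} {E F : Rel n} → (∀ u v → T (E u v) → T (F u v) → ⊥) →
  edgeCount (λ u v → E u v ∨ F u v) ≡ edgeCount E + edgeCount F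
edgeCount-∨ {n} {E} {F} disjoint = trans
  (count-cong (λ (u , v) → ∧-distribˡ-∨ (u <ᶠ v) (E u v) (F u v)) (pairs n))
  (count-∨ (λ (u , v) e f → disjoint u v (T-∧ʳ {u <ᶠ v} e) (T-∧ʳ {u <ᶠ v} f)) (pairs n))

edgeCount-mono : ∀ {n} {E F : Rel n} → E ⊆ᵣ F → edgeCount E ≤ edgeCount F
edgeCount-mono {n} E⊆F =
  count-mono (λ (u , v) e → T-∧⁺ (T-∧ˡ {u <ᶠ v} e) (E⊆F u v (T-∧ʳ {u <ᶠ v} e))) (pairs n)

edgeCount≢0 : ∀ {n} {E : Rel n} {k} → edgeCount E ≡ suc k → ∃[ a ] ∃[ b ] (T (E a b) × toℕ a < toℕ b)
edgeCount≢0 {n} eq with count≢0 (pairs n) eq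
... | (a , b) , e = a , b , T-∧ʳ {a <ᶠ b} e , ℕ.<ᵇ⇒< (toℕ a) (toℕ b) (T-∧ˡ {a <ᶠ b} e)

single : ∀ {n} → Fin n → Fin n → Rel n
single a b u v = (u == a ∧ v == b) ∨ (u == b ∧ v == a)

single⁻ : ∀ {n} {a b u v : Fin n} → T (single a b u v) → (u ≡ a × v ≡ b) ⊎ (u ≡ b × v ≡ a)
single⁻ {a = a} {b} {u} {v} e with T-∨⁻ {u == a ∧ v == b} e
... | inj₁ uv≡ab = inj₁ (==⇒≡ (T-∧ˡ {u == a} uv≡ab) , ==⇒≡ (T-∧ʳ {u == a} uv≡ab))
... | inj₂ uv≡ba = inj₂ (==⇒≡ (T-∧ˡ {u == b} uv≡ba) , ==⇒≡ (T-∧ʳ {u == b} uv≡ba))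

single-ab : ∀ {n} (a b : Fin n) → T (single a b a b)
single-ab a b = T-∨ˡ (T-∧⁺ (==-refl a) (==-refl b))

single-ba : ∀ {n} (a b : Fin n) → T (single a b b a)
single-ba a b = T-∨ʳ {b == a ∧ a == b} (T-∧⁺ (==-refl b) (==-refl a))

single-sym : ∀ {n} (a b : Fin n) → Symmetric (single a b)
single-sym a b u v = T-ext (flip u v) (flip v u)
  where
    flip : ∀ u v → T (single a b u v) → T (single a b v u)
    flip u v e with single⁻ {a = a} {b} {u} {v} e
    ... | inj₁ (refl , refl) = single-ba a b
    ... | inj₂ (refl , refl) = single-ab a b

single-swap : ∀ {n} (a b : Fin n) u v → single a b u v ≡ single b a u v
single-swap a b u v = ∨-comm (u == a ∧ v == b) (u == b ∧ v == a)

edgeCount-single< : ∀ {n} {a b : Fin n} → toℕ a < toℕ b → edgeCount (single a b) ≡ 1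
edgeCount-single< {n} {a} {b} a<b = begin
  count (λ (u , v) → u <ᶠ v ∧ single a b u v) (pairs n)
    ≡⟨ count-cong (λ (u , v) → forward-only u v) (pairs n) ⟩
  count (λ (u , v) → u == a ∧ v == b) (pairs n)
    ≡⟨ count-× (_== a) (_== b) (allFin n) (allFin n) ⟩
  count (_== a) (allFin n) * count (_== b) (allFin n)
    ≡⟨ cong₂ _*_ (count-==-allFin n a) (count-==-allFin n b) ⟩
  1 ∎
  where
    open ≡-Reasoning
    forward-only : ∀ u v → (u <ᶠ v ∧ single a b u v) ≡ (u == a ∧ v == b)
    forward-only u v = T-ext to from
      where
        to : T (u <ᶠ v ∧ single a b u v) → T (u == a ∧ v == b)
        to e with single⁻ {u = u} {v} (T-∧ʳ {u <ᶠ v} e)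
        ... | inj₁ (refl , refl) = T-∧⁺ (==-refl a) (==-refl b)
        ... | inj₂ (refl , refl) = ⊥-elim (ℕ.<-asym a<b (ℕ.<ᵇ⇒< (toℕ b) (toℕ a) (T-∧ˡ {u <ᶠ v} e)))
        from : T (u == a ∧ v == b) → T (u <ᶠ v ∧ single a b u v)
        from e with ==⇒≡ {u = u} (T-∧ˡ {u == a} e) | ==⇒≡ {u = v} (T-∧ʳ {u == a} e)
        ... | refl | refl = T-∧⁺ (ℕ.<⇒<ᵇ a<b) (single-ab a b)

edgeCount-single : ∀ {n} (a b : Fin n) → a ≢ b → edgeCount (single a b) ≡ 1
edgeCount-single a b a≢b with ℕ.<-cmp (toℕ a) (toℕ b)
... | tri< a<b _ _ = edgeCount-single< a<b
... | tri≈ _ a≡b _ = ⊥-elim (a≢b (toℕ-injective a≡b))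
... | tri> _ _ b<a = trans (edgeCount-cong (single-swap a b)) (edgeCount-single< b<a)

single⊆ : ∀ {n} {E : Rel n} {a b} → Symmetric E → T (E a b) → single a b ⊆ᵣ E
single⊆ {a = a} {b} E-sym ab u v uv with single⁻ {a = a} {b} {u} {v} uv
... | inj₁ (refl , refl) = ab
... | inj₂ (refl , refl) = subst T (E-sym a b) ab

edgeCount≡0⇒loops : ∀ {n} {E : Rel n} → Symmetric E → edgeCount E ≡ 0 → ∀ u v → T (E u v) → u ≡ v
edgeCount≡0⇒loops {E = E} E-sym none u v e with u ≟ᶠ v
... | yes u≡v = u≡v
... | no u≢v = ⊥-elim (1≰0 (begin
  1                       ≡⟨ sym (edgeCount-single u v u≢v) ⟩
  edgeCount (single u v)  ≤⟨ edgeCount-mono (single⊆ E-sym e) ⟩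
  edgeCount E             ≡⟨ none ⟩
  0                       ∎))
  where
    open ℕ.≤-Reasoning
    1≰0 : ¬ 1 ≤ 0
    1≰0 ()

record ConnectedOn {n} (U : Subset n) (E : Rel n) : Set where
  field
    symmetric : Symmetric E
    edge∈     : ∀ u v → T (E u v) → u ∈ U
    connects  : ∀ u v → u ∈ U → v ∈ U → Reach E u v
open ConnectedOn

edge∈ʳ : ∀ {n} {U : Subset n} {E} → ConnectedOn U E → ∀ u v → T (E u v) → v ∈ U
edge∈ʳ C u v e = edge∈ C v u (subst T (symmetric C u v) e)

SpanningTree : ∀ {n} → Subset n → Rel n → Set
SpanningTree U E = ∃[ F ] (F ⊆ᵣ E × ConnectedOn U F × suc (edgeCount F) ≡ ∣ U ∣)

module EdgeDeletion {n} {U : Subset n} {E : Rel n} (C : ConnectedOn U E)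
                    {a b : Fin n} (ab : T (E a b)) (a≢b : a ≢ b) where

  E∖ab : Rel n
  E∖ab u v = E u v ∧ not (single a b u v)

  E∖ab⊆E : E∖ab ⊆ᵣ E
  E∖ab⊆E u v e = T-∧ˡ {E u v} e

  E∖ab-sym : Symmetric E∖ab
  E∖ab-sym u v = cong₂ (λ x y → x ∧ not y) (symmetric C u v) (single-sym a b u v)

  E∖ab⁺ : ∀ {u v} → T (E u v) → single a b u v ≡ false → T (E∖ab u v)
  E∖ab⁺ {u} {v} e ¬ab = T-∧⁺ e (subst (T ∘ not) (sym ¬ab) tt)

  E∖ab-∌ab : ∀ u v → T (E∖ab u v) → T (single a b u v) → ⊥
  E∖ab-∌ab u v e = T-not-T (T-∧ʳ {E u v} e)

  edgeCount-E : edgeCount E ≡ suc (edgeCount E∖ab)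
  edgeCount-E = begin
    edgeCount E
      ≡⟨ edgeCount-cong (λ u v → ∨-absorbs-∧-not (single⊆ (symmetric C) ab u v)) ⟩
    edgeCount (λ u v → E∖ab u v ∨ single a b u v)
      ≡⟨ edgeCount-∨ E∖ab-∌ab ⟩
    edgeCount E∖ab + edgeCount (single a b)
      ≡⟨ cong (edgeCount E∖ab +_) (edgeCount-single a b a≢b) ⟩
    edgeCount E∖ab + 1
      ≡⟨ ℕ.+-comm (edgeCount E∖ab) 1 ⟩
    suc (edgeCount E∖ab) ∎
    where open ≡-Reasoning

  reach-via-ab : ∀ {y x} → Reach E y x → Reach E∖ab y x ⊎ Reach E∖ab a x ⊎ Reach E∖ab b x
  reach-via-ab here = inj₁ here
  reach-via-ab {y} (step {w = w} e p) with reach-via-ab p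
  ... | inj₂ q = inj₂ q
  ... | inj₁ q with single a b y w in ab?
  ...   | false = inj₁ (step (E∖ab⁺ e ab?) q)
  ...   | true with single⁻ {a = a} {b} {y} {w} (subst T (sym ab?) tt)
  ...     | inj₁ (refl , refl) = inj₂ (inj₂ q)
  ...     | inj₂ (refl , refl) = inj₂ (inj₁ q)

  from-a? : ∀ x → Dec (Reach E∖ab a x)
  from-a? x with reach-restrict? E∖ab U a x
  ... | yes p = yes (reach-mono restrict-⊆ p)
  ... | no ¬p = no (λ p → ¬p (reach-mono inside-U p))
    where
      inside-U : E∖ab ⊆ᵣ restrict E∖ab U
      inside-U u v e = restrict⁺ e (edge∈ C u v (E∖ab⊆E u v e)) (edge∈ʳ C u v (E∖ab⊆E u v e))

  module NonBridge (a↝b : Reach E∖ab a b) where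

    detour : ∀ {x y} → Reach E x y → Reach E∖ab x y
    detour here = here
    detour {x} (step {w = w} e p) with single a b x w in ab?
    ... | false = step (E∖ab⁺ e ab?) (detour p)
    ... | true with single⁻ {a = a} {b} {x} {w} (subst T (sym ab?) tt)
    ...   | inj₁ (refl , refl) = reach-trans a↝b (detour p)
    ...   | inj₂ (refl , refl) = reach-trans (reach-sym E∖ab-sym a↝b) (detour p)

    connected : ConnectedOn U E∖ab
    connected = record
      { symmetric = E∖ab-sym
      ; edge∈ = λ u v e → edge∈ C u v (E∖ab⊆E u v e)
      ; connects = λ u v u∈U v∈U → detour (connects C u v u∈U v∈U)
      }

  module Bridge (a↛b : ¬ Reach E∖ab a b) where

    side : Fin n → Bool
    side x = isYes (from-a? x)

    U₁ U₂ : Subset n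
    U₁ = U ∩ᵇ side
    U₂ = U ∩ᵇ (not ∘ side)

    ∈U₁⁺ : ∀ {x} → x ∈ U → Reach E∖ab a x → x ∈ U₁
    ∈U₁⁺ {x} x∈U a↝x = ∈-∩ᵇ⁺ x∈U (fromWitness {a? = from-a? x} a↝x)

    ∈U₂⁺ : ∀ {x} → x ∈ U → ¬ Reach E∖ab a x → x ∈ U₂
    ∈U₂⁺ {x} x∈U a↛x = ∈-∩ᵇ⁺ x∈U (fromWitnessFalse {a? = from-a? x} a↛x)

    ∈U₁⁻ : ∀ {x} → x ∈ U₁ → x ∈ U × Reach E∖ab a x
    ∈U₁⁻ {x} x∈U₁ = let (x∈U , t) = ∈-∩ᵇ⁻ x∈U₁ in x∈U , toWitness {a? = from-a? x} t

    ∈U₂⁻ : ∀ {x} → x ∈ U₂ → x ∈ U × ¬ Reach E∖ab a x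
    ∈U₂⁻ {x} x∈U₂ = let (x∈U , t) = ∈-∩ᵇ⁻ x∈U₂ in x∈U , toWitnessFalse {a? = from-a? x} t

    U₁∩U₂≡∅ : ∀ {x} → x ∈ U₁ → x ∈ U₂ → ⊥
    U₁∩U₂≡∅ x∈U₁ x∈U₂ = proj₂ (∈U₂⁻ x∈U₂) (proj₂ (∈U₁⁻ x∈U₁))

    a∈U₁ : a ∈ U₁
    a∈U₁ = ∈U₁⁺ (edge∈ C a b ab) here

    b∈U₂ : b ∈ U₂
    b∈U₂ = ∈U₂⁺ (edge∈ʳ C a b ab) a↛b

    U₁-closed : ∀ x y → x ∈ U₁ → T (E∖ab x y) → y ∈ U₁
    U₁-closed x y x∈U₁ e = ∈U₁⁺ (edge∈ʳ C x y (E∖ab⊆E x y e)) (reach-snoc (proj₂ (∈U₁⁻ x∈U₁)) e)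

    U₂-closed : ∀ x y → x ∈ U₂ → T (E∖ab x y) → y ∈ U₂
    U₂-closed x y x∈U₂ e =
      ∈U₂⁺ (edge∈ʳ C x y (E∖ab⊆E x y e)) (λ a↝y → proj₂ (∈U₂⁻ x∈U₂) (reach-snoc a↝y (subst T (E∖ab-sym x y) e)))

    E₁ E₂ : Rel n
    E₁ = restrict E∖ab U₁
    E₂ = restrict E∖ab U₂

    connected-from : ∀ {V} {c} → (∀ x y → x ∈ V → T (E∖ab x y) → y ∈ V) → c ∈ V →
      (∀ {x} → x ∈ V → Reach E∖ab c x) → ConnectedOn V (restrict E∖ab V)
    connected-from {V} {c} closed c∈V reaches = record
      { symmetric = restrict-sym E∖ab-sym
      ; edge∈ = λ u v → restrict-∈ˡ
      ; connects = λ u v u∈V v∈V → reach-trans (reach-sym (restrict-sym E∖ab-sym) (from-c u∈V)) (from-c v∈V)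
      }
      where
        from-c : ∀ {x} → x ∈ V → Reach (restrict E∖ab V) c x
        from-c x∈V = reach-within (_∈ V) (λ x y x∈V e → closed x y x∈V e , restrict⁺ e x∈V (closed x y x∈V e))
                                  c∈V (reaches x∈V)

    connected₁ : ConnectedOn U₁ E₁
    connected₁ = connected-from U₁-closed a∈U₁ (proj₂ ∘ ∈U₁⁻)

    connected₂ : ConnectedOn U₂ E₂
    connected₂ = connected-from U₂-closed b∈U₂ from-b
      where
        from-b : ∀ {x} → x ∈ U₂ → Reach E∖ab b x
        from-b {x} x∈U₂ with reach-via-ab (connects C b x (edge∈ʳ C a b ab) (proj₁ (∈U₂⁻ x∈U₂)))
        ... | inj₁ b↝x = b↝x
        ... | inj₂ (inj₁ a↝x) = ⊥-elim (proj₂ (∈U₂⁻ x∈U₂) a↝x)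
        ... | inj₂ (inj₂ b↝x) = b↝x

    edgeCount-E∖ab : edgeCount E∖ab ≡ edgeCount E₁ + edgeCount E₂
    edgeCount-E∖ab = trans (edgeCount-cong E∖ab≡E₁∨E₂)
      (edgeCount-∨ {E = E₁} {E₂} (λ u v e₁ e₂ → U₁∩U₂≡∅ (restrict-∈ˡ {E = E∖ab} e₁) (restrict-∈ˡ {E = E∖ab} e₂)))
      where
        E∖ab≡E₁∨E₂ : ∀ u v → E∖ab u v ≡ (E₁ u v ∨ E₂ u v)
        E∖ab≡E₁∨E₂ u v = T-ext to (λ e → [ restrict-⊆ u v , restrict-⊆ u v ] (T-∨⁻ {E₁ u v} e))
          where
            to : T (E∖ab u v) → T (E₁ u v ∨ E₂ u v)
            to e with from-a? u | edge∈ C u v (E∖ab⊆E u v e)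
            ... | yes a↝u | u∈U = let u∈U₁ = ∈U₁⁺ u∈U a↝u in T-∨ˡ (restrict⁺ e u∈U₁ (U₁-closed u v u∈U₁ e))
            ... | no a↛u | u∈U = let u∈U₂ = ∈U₂⁺ u∈U a↛u in T-∨ʳ {E₁ u v} (restrict⁺ e u∈U₂ (U₂-closed u v u∈U₂ e))

    ∣U∣≡∣U₁∣+∣U₂∣ : ∣ U ∣ ≡ ∣ U₁ ∣ + ∣ U₂ ∣
    ∣U∣≡∣U₁∣+∣U₂∣ = ∣∩ᵇ∣+∣∩ᵇnot∣ U side

    module Join {F₁ F₂ : Rel n}
                (F₁⊆E₁ : F₁ ⊆ᵣ E₁) (C₁ : ConnectedOn U₁ F₁) (size₁ : suc (edgeCount F₁) ≡ ∣ U₁ ∣)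
                (F₂⊆E₂ : F₂ ⊆ᵣ E₂) (C₂ : ConnectedOn U₂ F₂) (size₂ : suc (edgeCount F₂) ≡ ∣ U₂ ∣) where
      F : Rel n
      F u v = (F₁ u v ∨ F₂ u v) ∨ single a b u v

      F₁⊆F : F₁ ⊆ᵣ F
      F₁⊆F u v f = T-∨ˡ (T-∨ˡ f)

      F₂⊆F : F₂ ⊆ᵣ F
      F₂⊆F u v f = T-∨ˡ (T-∨ʳ {F₁ u v} f)

      F⊆E : F ⊆ᵣ E
      F⊆E u v f with T-∨⁻ {F₁ u v ∨ F₂ u v} f
      ... | inj₂ uv≡ab = single⊆ (symmetric C) ab u v uv≡ab
      ... | inj₁ f₁₂ with T-∨⁻ {F₁ u v} f₁₂
      ...   | inj₁ f₁ = E∖ab⊆E u v (restrict-⊆ u v (F₁⊆E₁ u v f₁))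
      ...   | inj₂ f₂ = E∖ab⊆E u v (restrict-⊆ u v (F₂⊆E₂ u v f₂))

      F-sym : Symmetric F
      F-sym u v = cong₂ _∨_ (cong₂ _∨_ (symmetric C₁ u v) (symmetric C₂ u v)) (single-sym a b u v)

      to-a : ∀ x → x ∈ U → Reach F x a
      to-a x x∈U with from-a? x
      ... | yes a↝x = reach-mono F₁⊆F (connects C₁ x a (∈U₁⁺ x∈U a↝x) a∈U₁)
      ... | no a↛x = reach-snoc (reach-mono F₂⊆F (connects C₂ x b (∈U₂⁺ x∈U a↛x) b∈U₂))
                                (T-∨ʳ {F₁ b a ∨ F₂ b a} (single-ba a b))

      connected : ConnectedOn U F
      connected = record
        { symmetric = F-sym
        ; edge∈ = λ u v f → edge∈ C u v (F⊆E u v f)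
        ; connects = λ u v u∈U v∈U → reach-trans (to-a u u∈U) (reach-sym F-sym (to-a v v∈U))
        }

      F₁∌F₂ : ∀ u v → T (F₁ u v) → T (F₂ u v) → ⊥
      F₁∌F₂ u v f₁ f₂ = U₁∩U₂≡∅ (edge∈ C₁ u v f₁) (edge∈ C₂ u v f₂)

      F₁₂∌ab : ∀ u v → T (F₁ u v ∨ F₂ u v) → T (single a b u v) → ⊥
      F₁₂∌ab u v f uv≡ab with single⁻ {a = a} {b} {u} {v} uv≡ab | T-∨⁻ {F₁ u v} f
      ... | inj₁ (refl , refl) | inj₁ f₁ = U₁∩U₂≡∅ (edge∈ʳ C₁ a b f₁) b∈U₂
      ... | inj₁ (refl , refl) | inj₂ f₂ = U₁∩U₂≡∅ a∈U₁ (edge∈ C₂ a b f₂)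
      ... | inj₂ (refl , refl) | inj₁ f₁ = U₁∩U₂≡∅ (edge∈ C₁ b a f₁) b∈U₂
      ... | inj₂ (refl , refl) | inj₂ f₂ = U₁∩U₂≡∅ a∈U₁ (edge∈ʳ C₂ b a f₂)

      size : suc (edgeCount F) ≡ ∣ U ∣
      size = begin
        suc (edgeCount F)
          ≡⟨ cong suc (edgeCount-∨ {E = λ u v → F₁ u v ∨ F₂ u v} F₁₂∌ab) ⟩
        suc (edgeCount (λ u v → F₁ u v ∨ F₂ u v) + edgeCount (single a b))
          ≡⟨ cong₂ (λ x y → suc (x + y)) (edgeCount-∨ F₁∌F₂) (edgeCount-single a b a≢b) ⟩
        suc (edgeCount F₁ + edgeCount F₂ + 1)
          ≡⟨ cong suc (trans (ℕ.+-assoc (edgeCount F₁) _ 1) (cong (edgeCount F₁ +_) (ℕ.+-comm (edgeCount F₂) 1))) ⟩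
        suc (edgeCount F₁) + suc (edgeCount F₂)
          ≡⟨ cong₂ _+_ size₁ size₂ ⟩
        ∣ U₁ ∣ + ∣ U₂ ∣
          ≡⟨ sym ∣U∣≡∣U₁∣+∣U₂∣ ⟩
        ∣ U ∣ ∎
        where open ≡-Reasoning

    join : SpanningTree U₁ E₁ → SpanningTree U₂ E₂ → SpanningTree U E
    join (F₁ , F₁⊆E₁ , C₁ , size₁) (F₂ , F₂⊆E₂ , C₂ , size₂) = F , F⊆E , connected , size
      where
        open Join F₁⊆E₁ C₁ size₁ F₂⊆E₂ C₂ size₂

  smaller-trees⇒spanningTree :
    (∀ {V : Subset n} {F y} → ConnectedOn V F → edgeCount F ≤ edgeCount E∖ab → y ∈ V → SpanningTree V F) →
    ∀ {x} → x ∈ U → SpanningTree U E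
  smaller-trees⇒spanningTree tree x∈U with from-a? b
  ... | yes a↝b =
    let (F , F⊆E∖ab , C′ , size) = tree (NonBridge.connected a↝b) ℕ.≤-refl x∈U
    in F , (λ u v f → E∖ab⊆E u v (F⊆E∖ab u v f)) , C′ , size
  ... | no a↛b = join (tree connected₁ E₁≤ a∈U₁) (tree connected₂ E₂≤ b∈U₂)
    where
      open Bridge a↛b
      E₁≤ : edgeCount E₁ ≤ edgeCount E∖ab
      E₁≤ = subst (edgeCount E₁ ≤_) (sym edgeCount-E∖ab) (ℕ.m≤m+n _ _)
      E₂≤ : edgeCount E₂ ≤ edgeCount E∖ab
      E₂≤ = subst (edgeCount E₂ ≤_) (sym edgeCount-E∖ab) (ℕ.m≤n+m _ _)

spanningTree : ∀ k {n} {U : Subset n} {E : Rel n} {x} →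
  ConnectedOn U E → edgeCount E ≤ k → x ∈ U → SpanningTree U E
spanningTree k {U = U} {E} C _ x∈U with edgeCount E in eq
... | zero = E , (λ _ _ e → e) , C , trans (cong suc eq) (ℕ.≤-antisym (x∈p⇒1≤∣p∣ x∈U) ∣U∣≤1)
  where
    ∣U∣≤1 : ∣ U ∣ ≤ 1
    ∣U∣≤1 = ∣p∣≤1 U (λ u v u∈U v∈U → reach-loops (edgeCount≡0⇒loops (symmetric C) eq) (connects C u v u∈U v∈U))
spanningTree (suc k) {E = E} C (s≤s m≤k) x∈U | suc m with edgeCount≢0 {E = E} eq
... | a , b , ab , a<b =
  smaller-trees⇒spanningTree (λ C′ F≤ y∈V → spanningTree k C′ (ℕ.≤-trans F≤ E∖ab≤k) y∈V) x∈U
  where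
    open EdgeDeletion C ab (<⇒≢ a<b)
    E∖ab≤k : edgeCount E∖ab ≤ k
    E∖ab≤k = subst (_≤ k) (ℕ.suc-injective (trans (sym eq) edgeCount-E)) m≤k

∣U∣≤1+edgeCount : ∀ {n} {U : Subset n} {E : Rel n} → ConnectedOn U E → ∣ U ∣ ≤ suc (edgeCount E)
∣U∣≤1+edgeCount {U = U} {E} C with nonempty? U
... | yes (x , x∈U) =
  let (F , F⊆E , _ , size) = spanningTree _ C ℕ.≤-refl x∈U
  in subst (_≤ suc (edgeCount E)) size (s≤s (edgeCount-mono F⊆E))
... | no empty = ℕ.≤-trans (ℕ.≤-reflexive (∣p∣≡0 U (λ x x∈U → empty (x , x∈U)))) z≤n

module _ {n} (G : Graph n) where

  delAdj⁺ : ∀ {S u v} → T (adj G u v) → u ∉ S → v ∉ S → T (delAdj G S u v)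
  delAdj⁺ e u∉S v∉S = T-∧⁺ e (T-∧⁺ (∉⇒T-not u∉S) (∉⇒T-not v∉S))

  delAdj-adj : ∀ {S u v} → T (delAdj G S u v) → T (adj G u v)
  delAdj-adj {u = u} {v} e = T-∧ˡ {adj G u v} e

  delAdj-∉ˡ : ∀ {S u v} → T (delAdj G S u v) → u ∉ S
  delAdj-∉ˡ {S} {u} {v} e = T-not⇒∉ (T-∧ˡ {not (lookup S u)} (T-∧ʳ {adj G u v} e))

  delAdj-∉ʳ : ∀ {S u v} → T (delAdj G S u v) → v ∉ S
  delAdj-∉ʳ {S} {u} {v} e = T-not⇒∉ (T-∧ʳ {not (lookup S u)} (T-∧ʳ {adj G u v} e))

  delAdj-sym : ∀ S → Symmetric (delAdj G S)
  delAdj-sym S u v = T-ext (flip u v) (flip v u)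
    where
      flip : ∀ u v → T (delAdj G S u v) → T (delAdj G S v u)
      flip u v e = delAdj⁺ (subst T (adj-sym G u v) (delAdj-adj {S} e)) (delAdj-∉ʳ {S} e) (delAdj-∉ˡ {S} e)

  delAdj-antitone : ∀ {S X} → S ⊆ X → delAdj G X ⊆ᵣ delAdj G S
  delAdj-antitone {X = X} S⊆X u v e = delAdj⁺ (delAdj-adj {X} e) (delAdj-∉ˡ {X} e ∘ S⊆X) (delAdj-∉ʳ {X} e ∘ S⊆X)

  delAdj≡restrict-∁ : ∀ S u v → delAdj G S u v ≡ restrict (adj G) (∁ S) u v
  delAdj≡restrict-∁ S u v = T-ext
    (λ e → restrict⁺ (delAdj-adj {S} e) (x∉p⇒x∈∁p (delAdj-∉ˡ {S} e)) (x∉p⇒x∈∁p (delAdj-∉ʳ {S} e)))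
    (λ e → delAdj⁺ (restrict-⊆ u v e) (x∈∁p⇒x∉p (restrict-∈ˡ e)) (x∈∁p⇒x∉p (restrict-∈ʳ e)))

  reach-delAdj? : ∀ S u v → Dec (Reach (delAdj G S) u v)
  reach-delAdj? S u v with reach-restrict? (adj G) (∁ S) u v
  ... | yes p = yes (reach-mono (λ x y → subst T (sym (delAdj≡restrict-∁ S x y))) p)
  ... | no ¬p = no (¬p ∘ reach-mono (λ x y → subst T (delAdj≡restrict-∁ S x y)))

  separating? : ∀ S → Dec (Separating G S)
  separating? S = any? λ u → any? λ v → ¬? (u ∈? S) ×-dec ¬? (v ∈? S) ×-dec ¬? (reach-delAdj? S u v)

  ¬separating⇒reach : ∀ {S} → ¬ Separating G S → ∀ u v → u ∉ S → v ∉ S → Reach (delAdj G S) u v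
  ¬separating⇒reach {S} ¬sep u v u∉S v∉S with reach-delAdj? S u v
  ... | yes p = p
  ... | no ¬p = ⊥-elim (¬sep (u , v , u∉S , v∉S , ¬p))

  separating-⊆ : ∀ {S X} → S ⊆ X → ∀ {u v} → u ∉ X → v ∉ X → ¬ Reach (delAdj G S) u v → Separating G X
  separating-⊆ S⊆X u∉X v∉X ¬p = _ , _ , u∉X , v∉X , ¬p ∘ reach-mono (delAdj-antitone S⊆X)

  complete⇒¬separating : Complete G → ∀ S → ¬ Separating G S
  complete⇒¬separating complete S (u , v , u∉S , v∉S , ¬p) with u ≟ᶠ v
  ... | yes refl = ¬p here
  ... | no u≢v = ¬p (step (delAdj⁺ (complete u v u≢v) u∉S v∉S) here)

  nonadjacent⇒separating : ∀ {u v} → u ≢ v → ¬ T (adj G u v) → Separating G (⊤ - u - v)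
  nonadjacent⇒separating {u} {v} u≢v ¬uv = u , v , u∉ , v∉ , ¬p
    where
      u∉ : u ∉ ⊤ - u - v
      u∉ u∈ = proj₂ (x∈p-y⇒x∈p∧x≢y (proj₁ (x∈p-y⇒x∈p∧x≢y u∈))) refl
      v∉ : v ∉ ⊤ - u - v
      v∉ v∈ = proj₂ (x∈p-y⇒x∈p∧x≢y v∈) refl
      ¬p : ¬ Reach (delAdj G (⊤ - u - v)) u v
      ¬p here = u≢v refl
      ¬p (step {w = w} e _) with w ≟ᶠ u | w ≟ᶠ v
      ... | yes refl | _ = subst T (irrefl G w) (delAdj-adj {⊤ - u - v} e)
      ... | no _ | yes refl = ¬uv (delAdj-adj {⊤ - u - v} e)
      ... | no w≢u | no w≢v = delAdj-∉ʳ {⊤ - u - v} e (x∈p∧x≢y⇒x∈p-y (x∈p∧x≢y⇒x∈p-y ∈⊤ w≢u) w≢v)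

  complete? : Complete G ⊎ ∃[ u ] ∃[ v ] (u ≢ v × ¬ T (adj G u v))
  complete? with any? (λ u → any? (λ v → ¬? (u ≟ᶠ v) ×-dec ¬? (T? (adj G u v))))
  ... | yes nonadjacent = inj₂ nonadjacent
  ... | no none = inj₁ λ u v u≢v → decidable-stable (T? (adj G u v))
                                      (λ ¬uv → none (u , v , u≢v , ¬uv))

  SeparatorOfSize : ℕ → Set
  SeparatorOfSize j = ∃[ S ] (Separating G S × ∣ S ∣ ≡ j)

  κ≥⇒separators≥ : ∀ {k} → KappaAtLeast G k → ∀ S → Separating G S → k ≤ ∣ S ∣
  κ≥⇒separators≥ (c , inj₁ (complete , _) , k≤c) S sep = ⊥-elim (complete⇒¬separating complete S sep)
  κ≥⇒separators≥ (c , inj₂ (_ , _ , c≤) , k≤c) S sep = ℕ.≤-trans k≤c (c≤ S sep)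

  separators≥⇒κ≥ : ∀ {k} → k ≤ n ∸ 1 → (∀ S → Separating G S → k ≤ ∣ S ∣) → KappaAtLeast G k
  separators≥⇒κ≥ k≤n-1 large with complete?
  ... | inj₁ complete = n ∸ 1 , inj₁ (complete , refl) , k≤n-1
  ... | inj₂ (u , v , u≢v , ¬uv)
    with least SeparatorOfSize (λ j → anySubset? (λ S → separating? S ×-dec ∣ S ∣ ℕ.≟ j))
               (_ , nonadjacent⇒separating u≢v ¬uv , refl)
  ...   | c , (S , sep , ∣S∣≡c) , c≤ =
    c , inj₂ ((λ complete → ¬uv (complete u v u≢v)) , (S , sep , ∣S∣≡c) ,
              (λ S′ sep′ → c≤ ∣ S′ ∣ (S′ , sep′ , refl))) ,
    subst (_ ≤_) ∣S∣≡c (large S sep)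

  InducesConnected : Subset n → Set
  InducesConnected U = ∀ u v → u ∈ U → v ∈ U → Reach (restrict (adj G) U) u v

  module _ {S k} (H : SteinerSubgraph G S k) where
    open SteinerSubgraph H

    steiner-connected : ConnectedOn U E
    steiner-connected = record { symmetric = E-sym ; edge∈ = E-ends ; connects = conn }

    ∣U∣≤1+k : ∣ U ∣ ≤ suc k
    ∣U∣≤1+k = subst (λ m → ∣ U ∣ ≤ suc m) size (∣U∣≤1+edgeCount steiner-connected)

    ∣S∣≤1+k : ∣ S ∣ ≤ suc k
    ∣S∣≤1+k = ℕ.≤-trans (p⊆q⇒∣p∣≤∣q∣ S⊆U) ∣U∣≤1+k

    short-steiner⇒¬separating-∁ : suc k ≤ ∣ S ∣ → ¬ Separating G (∁ S)
    short-steiner⇒¬separating-∁ 1+k≤∣S∣ (u , v , u∉∁S , v∉∁S , ¬p) =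
      ¬p (reach-mono inside-S (conn u v (S⊆U (x∉∁p⇒x∈p u∉∁S)) (S⊆U (x∉∁p⇒x∈p v∉∁S))))
      where
        U⊆S : U ⊆ S
        U⊆S = p⊆q∧∣q∣≤∣p∣⇒q⊆p S⊆U (ℕ.≤-trans ∣U∣≤1+k 1+k≤∣S∣)
        inside-S : E ⊆ᵣ delAdj G (∁ S)
        inside-S x y e = delAdj⁺ (E-sub x y e) (x∈p⇒x∉∁p (U⊆S (E-ends x y e)))
                                 (x∈p⇒x∉∁p (U⊆S (E-ends y x (subst T (E-sym x y) e))))

  steinerSubgraph-within : ∀ {S U x} → x ∈ U → S ⊆ U → InducesConnected U →
    ∃[ k ] (suc k ≡ ∣ U ∣ × SteinerSubgraph G S k)
  steinerSubgraph-within {S} {U} x∈U S⊆U U-connected =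
    let (F , F⊆ , C , size) = spanningTree _ G[U] ℕ.≤-refl x∈U
    in edgeCount F , size , record
      { U = U ; E = F ; E-sym = symmetric C ; E-sub = λ u v f → restrict-⊆ u v (F⊆ u v f)
      ; E-ends = edge∈ C ; S⊆U = S⊆U ; conn = connects C ; size = refl }
    where
      G[U] : ConnectedOn U (restrict (adj G) U)
      G[U] = record { symmetric = restrict-sym (adj-sym G) ; edge∈ = λ u v → restrict-∈ˡ ; connects = U-connected }

  steinerDist-of-connected : ∀ {S k} → InducesConnected S → ∣ S ∣ ≡ suc k → SteinerDist G S k
  steinerDist-of-connected {S} S-connected ∣S∣≡1+k with element S ∣S∣≡1+k
  ... | x , x∈S with steinerSubgraph-within x∈S (λ s∈S → s∈S) S-connected
  ...   | k′ , 1+k′≡∣S∣ , H =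
    subst (SteinerSubgraph G S) (ℕ.suc-injective (trans 1+k′≡∣S∣ ∣S∣≡1+k)) H ,
    λ j H′ → ℕ.≤-pred (subst (_≤ suc j) ∣S∣≡1+k (∣S∣≤1+k H′))

  ¬separating-∁⇒connected : ∀ {S} → ¬ Separating G (∁ S) → InducesConnected S
  ¬separating-∁⇒connected {S} ¬sep u v u∈S v∈S =
    reach-mono G-S⊆G[S] (¬separating⇒reach ¬sep u v (x∈p⇒x∉∁p u∈S) (x∈p⇒x∉∁p v∈S))
    where
      G-S⊆G[S] : delAdj G (∁ S) ⊆ᵣ restrict (adj G) S
      G-S⊆G[S] x y = subst T (trans (delAdj≡restrict-∁ (∁ S) x y) (cong (λ A → restrict (adj G) A x y) (∁-involutive S)))

  module _ (G-connected : Connected G) where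

    spanningSteinerSubgraph : ∀ S → 1 ≤ n → SteinerSubgraph G S (n ∸ 1)
    spanningSteinerSubgraph S 1≤n
      with steinerSubgraph-within {x = fromℕ< 1≤n} ∈⊤ (λ _ → ∈⊤)
             (λ u v _ _ → reach-mono (λ x y e → restrict⁺ e ∈⊤ ∈⊤) (G-connected u v))
    ... | k , 1+k≡∣⊤∣ , H = subst (SteinerSubgraph G S) (cong (_∸ 1) (trans 1+k≡∣⊤∣ (∣⊤∣≡n n))) H

    steinerDist≤n∸1 : ∀ {S d} → 1 ≤ n → SteinerDist G S d → d ≤ n ∸ 1
    steinerDist≤n∸1 {S} 1≤n (_ , d≤) = d≤ _ (spanningSteinerSubgraph S 1≤n)

    ¬¬steinerDist : ∀ S → 1 ≤ n → ¬ ¬ (∃[ d ] SteinerDist G S d)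
    ¬¬steinerDist S 1≤n = ¬¬-least (SteinerSubgraph G S) (spanningSteinerSubgraph S 1≤n)

    private
      reach-avoiding : ∀ p → (∀ w₁ w₂ → T (adj G p w₁) → T (adj G p w₂) → Reach (delAdj G ⁅ p ⁆) w₁ w₂) →
        ∀ {a b} → a ≢ p → b ≢ p → Reach (adj G) a b → Reach (delAdj G ⁅ p ⁆) a b
      reach-avoiding p linked a≢p b≢p here = here
      reach-avoiding p linked {a} a≢p b≢p (step {w = w} e r) with w ≟ᶠ p
      ... | no w≢p = step (delAdj⁺ e (x≢y⇒x∉⁅y⁆ a≢p) (x≢y⇒x∉⁅y⁆ w≢p)) (reach-avoiding p linked w≢p b≢p r)
      ... | yes refl with r
      ...   | here = ⊥-elim (b≢p refl)
      ...   | step {w = w₂} e₂ r₂ =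
        reach-trans (linked a w₂ (subst T (adj-sym G a w) e) e₂) (reach-avoiding p linked w₂≢p b≢p r₂)
        where
          w₂≢p : w₂ ≢ w
          w₂≢p refl = subst T (irrefl G w) e₂

    linked-neighbours⇒¬cut : ∀ p → (∀ w₁ w₂ → T (adj G p w₁) → T (adj G p w₂) → Reach (delAdj G ⁅ p ⁆) w₁ w₂) →
      ¬ CutVertex G p
    linked-neighbours⇒¬cut p linked (a , b , a≢p , b≢p , ¬p) = ¬p (reach-avoiding p linked a≢p b≢p (G-connected a b))

    neighbours⊆⇒¬cut : ∀ {p c d} → (∀ w → T (adj G p w) → w ≡ c ⊎ w ≡ d) → Reach (delAdj G ⁅ p ⁆) c d →
      ¬ CutVertex G p
    neighbours⊆⇒¬cut {p} {c} {d} N⊆cd c↝d = linked-neighbours⇒¬cut p linked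
      where
        linked : ∀ w₁ w₂ → T (adj G p w₁) → T (adj G p w₂) → Reach (delAdj G ⁅ p ⁆) w₁ w₂
        linked w₁ w₂ e₁ e₂ with N⊆cd w₁ e₁ | N⊆cd w₂ e₂
        ... | inj₁ refl | inj₁ refl = here
        ... | inj₂ refl | inj₂ refl = here
        ... | inj₁ refl | inj₂ refl = c↝d
        ... | inj₂ refl | inj₁ refl = reach-sym (delAdj-sym ⁅ p ⁆) c↝d

    module _ {x s₀ : Fin n} where

      private
        R : Fin n → Set
        R w = Reach (delAdj G ⁅ x ⁆) w s₀

        edge-avoiding-x : ∀ {a b} → T (adj G a b) → a ≢ x → b ≢ x → T (delAdj G ⁅ x ⁆ a b)
        edge-avoiding-x e a≢x b≢x = delAdj⁺ e (x≢y⇒x∉⁅y⁆ a≢x) (x≢y⇒x∉⁅y⁆ b≢x)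

        neighbours-of-unreached : ∀ {r s} → r ≢ x → ¬ R r → (∀ w → w ≢ x → w ≢ r → w ≢ s → R w) →
          ∀ w → T (adj G r w) → w ≡ x ⊎ w ≡ s
        neighbours-of-unreached {r} {s} r≢x ¬Rr rest w e with w ≟ᶠ x | w ≟ᶠ r | w ≟ᶠ s
        ... | yes w≡x | _ | _ = inj₁ w≡x
        ... | no _ | yes refl | _ = ⊥-elim (subst T (irrefl G w) e)
        ... | no _ | no _ | yes w≡s = inj₂ w≡s
        ... | no w≢x | no w≢r | no w≢s = ⊥-elim (¬Rr (step (edge-avoiding-x e r≢x w≢x) (rest w w≢x w≢r w≢s)))

      cut-vertex-reaches : ∀ {p q} → p ≢ x → q ≢ x → p ≢ q → CutVertex G p → CutVertex G q →
        (∀ w → w ≢ x → w ≢ p → w ≢ q → R w) → ¬ ¬ R p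
      cut-vertex-reaches {p} {q} p≢x q≢x p≢q p-cut q-cut rest ¬Rp with reach-delAdj? ⁅ x ⁆ q s₀
      ... | yes Rq = neighbours⊆⇒¬cut N[p]⊆x here p-cut
        where
          N[p]⊆x : ∀ w → T (adj G p w) → w ≡ x ⊎ w ≡ x
          N[p]⊆x w e with neighbours-of-unreached p≢x ¬Rp rest w e
          ... | inj₁ w≡x = inj₁ w≡x
          ... | inj₂ refl = ⊥-elim (¬Rp (step (edge-avoiding-x e p≢x q≢x) Rq))
      ... | no ¬Rq with T? (adj G p x)
      ...   | yes px = neighbours⊆⇒¬cut N[q]⊆xp (step (delAdj⁺ px (x≢y⇒x∉⁅y⁆ p≢q) (x≢y⇒x∉⁅y⁆ (q≢x ∘ sym))) here) q-cut
        where
          N[q]⊆xp : ∀ w → T (adj G q w) → w ≡ p ⊎ w ≡ x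
          N[q]⊆xp w e with neighbours-of-unreached q≢x ¬Rq (λ w w≢x w≢q w≢p → rest w w≢x w≢p w≢q) w e
          ... | inj₁ w≡x = inj₂ w≡x
          ... | inj₂ w≡p = inj₁ w≡p
      ...   | no ¬px = neighbours⊆⇒¬cut N[p]⊆q here p-cut
        where
          N[p]⊆q : ∀ w → T (adj G p w) → w ≡ q ⊎ w ≡ q
          N[p]⊆q w e with neighbours-of-unreached p≢x ¬Rp rest w e
          ... | inj₁ refl = ⊥-elim (¬px e)
          ... | inj₂ w≡q = inj₁ w≡q

    three-cut-vertices⇒∈steiner : ∀ {x p q S k} → x ≢ p → x ≢ q → p ≢ q →
      CutVertex G x → CutVertex G p → CutVertex G q → (∀ w → w ≢ x → w ≢ p → w ≢ q → w ∈ S) →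
      ∀ {s₀} → s₀ ∈ S → (H : SteinerSubgraph G S k) → x ∈ SteinerSubgraph.U H
    three-cut-vertices⇒∈steiner {x} {p} {q} {S} x≢p x≢q p≢q x-cut p-cut q-cut rest {s₀} s₀∈S H
      with x ∈? SteinerSubgraph.U H
    ... | yes x∈U = x∈U
    ... | no x∉U = ⊥-elim (x-cut-in-component x-cut)
      where
        open SteinerSubgraph H
        R : Fin n → Set
        R w = Reach (delAdj G ⁅ x ⁆) w s₀

        ∈U⇒≢x : ∀ {w} → w ∈ U → w ≢ x
        ∈U⇒≢x w∈U refl = x∉U w∈U

        S-reaches : ∀ w → w ∈ S → R w
        S-reaches w w∈S = reach-mono
          (λ a b e → delAdj⁺ (E-sub a b e) (x≢y⇒x∉⁅y⁆ (∈U⇒≢x (E-ends a b e)))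
                             (x≢y⇒x∉⁅y⁆ (∈U⇒≢x (E-ends b a (subst T (E-sym a b) e)))))
          (conn w s₀ (S⊆U w∈S) (S⊆U s₀∈S))

        rest-reaches : ∀ w → w ≢ x → w ≢ p → w ≢ q → R w
        rest-reaches w w≢x w≢p w≢q = S-reaches w (rest w w≢x w≢p w≢q)

        all-reach : ∀ t → t ≢ x → ¬ ¬ R t
        all-reach t t≢x ¬Rt with t ≟ᶠ p | t ≟ᶠ q
        ... | yes refl | _ = cut-vertex-reaches (x≢p ∘ sym) (x≢q ∘ sym) p≢q p-cut q-cut rest-reaches ¬Rt
        ... | no _ | yes refl = cut-vertex-reaches (x≢q ∘ sym) (x≢p ∘ sym) (p≢q ∘ sym) q-cut p-cut
                                  (λ w w≢x w≢q w≢p → rest-reaches w w≢x w≢p w≢q) ¬Rt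
        ... | no t≢p | no t≢q = ¬Rt (rest-reaches t t≢x t≢p t≢q)

        x-cut-in-component : ¬ CutVertex G x
        x-cut-in-component (a , b , a≢x , b≢x , ¬a↝b) with reach-delAdj? ⁅ x ⁆ a s₀ | reach-delAdj? ⁅ x ⁆ b s₀
        ... | yes Ra | yes Rb = ¬a↝b (reach-trans Ra (reach-sym (delAdj-sym ⁅ x ⁆) Rb))
        ... | no ¬Ra | _ = all-reach a a≢x ¬Ra
        ... | _ | no ¬Rb = all-reach b b≢x ¬Rb

  cutVertex? : ∀ t → Dec (CutVertex G t)
  cutVertex? t = any? λ a → any? λ b → ¬? (a ≟ᶠ t) ×-dec ¬? (b ≟ᶠ t) ×-dec ¬? (reach-delAdj? ⁅ t ⁆ a b)

  ¬cut⇒connected-⊤-t : ∀ {t} → ¬ CutVertex G t → InducesConnected (⊤ - t)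
  ¬cut⇒connected-⊤-t {t} ¬cut u v u∈ v∈ with reach-delAdj? ⁅ t ⁆ u v
  ... | yes p = reach-mono G-t⊆G[⊤-t] p
    where
      ∈⊤-t : ∀ {w} → w ∉ ⁅ t ⁆ → w ∈ ⊤ - t
      ∈⊤-t w∉ = x∈p∧x≢y⇒x∈p-y ∈⊤ (x∉⁅y⁆⇒x≢y w∉)
      G-t⊆G[⊤-t] : delAdj G ⁅ t ⁆ ⊆ᵣ restrict (adj G) (⊤ - t)
      G-t⊆G[⊤-t] a b e = restrict⁺ (delAdj-adj {⁅ t ⁆} e) (∈⊤-t (delAdj-∉ˡ {⁅ t ⁆} e)) (∈⊤-t (delAdj-∉ʳ {⁅ t ⁆} e))
  ... | no ¬p = ⊥-elim (¬cut (u , v , proj₂ (x∈p-y⇒x∈p∧x≢y u∈) , proj₂ (x∈p-y⇒x∈p∧x≢y v∈) , ¬p))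

  ¬cut-outside⇒steinerDist≤n∸2 : ∀ {S d t s₀} → SteinerDist G S d → s₀ ∈ S → t ∉ S → ¬ CutVertex G t →
    2 + d ≤ n
  ¬cut-outside⇒steinerDist≤n∸2 {S} {d} {t} (_ , d≤) s₀∈S t∉S ¬cut
    with steinerSubgraph-within (S⊆⊤-t s₀∈S) S⊆⊤-t (¬cut⇒connected-⊤-t ¬cut)
    where
      S⊆⊤-t : S ⊆ ⊤ - t
      S⊆⊤-t {s} s∈S = x∈p∧x≢y⇒x∈p-y ∈⊤ (λ { refl → t∉S s∈S })
  ... | k , 1+k≡∣⊤-t∣ , H = begin
    2 + d                ≤⟨ s≤s (s≤s (d≤ k H)) ⟩
    2 + k                ≡⟨ cong suc 1+k≡∣⊤-t∣ ⟩
    suc ∣ ⊤ - t ∣        ≡⟨ sym (∣p∣≡1+∣p-x∣ ⊤ {t} ∈⊤) ⟩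
    ∣ ⊤ {n} ∣            ≡⟨ ∣⊤∣≡n n ⟩
    n                    ∎
    where open ℕ.≤-Reasoning

-- Here n = 5 + m, so that n ∸ 1, n ∸ 3 and n ∸ 4 are 4 + m, 2 + m and 1 + m.
module _ {m} (G : Graph (5 + m)) (G-connected : Connected G) where

  private
    1≤n : 1 ≤ 5 + m
    1≤n = s≤s z≤n

    ∣∁S∣≡3 : ∀ S → ∣ S ∣ ≡ 2 + m → ∣ ∁ S ∣ ≡ 3
    ∣∁S∣≡3 S ∣S∣≡2+m = trans (∣∁p∣≡n∸∣p∣ S) (trans (cong (5 + m ∸_) ∣S∣≡2+m) (ℕ.m+n∸n≡m 3 m))

    ∣∁X∣≡2+m : ∀ X → ∣ X ∣ ≡ 3 → ∣ ∁ X ∣ ≡ 2 + m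
    ∣∁X∣≡2+m X ∣X∣≡3 = trans (∣∁p∣≡n∸∣p∣ X) (cong (5 + m ∸_) ∣X∣≡3)

  κ≥4⇒sdiam≡n∸4 : KappaAtLeast G 4 → SDiam G (2 + m) (1 + m)
  κ≥4⇒sdiam≡n∸4 κ≥4 =
    (S₀ , ∣S₀∣≡2+m , distance S₀ ∣S₀∣≡2+m) , λ S ∣S∣≡2+m d (_ , d≤) → d≤ _ (proj₁ (distance S ∣S∣≡2+m))
    where
      distance : ∀ S → ∣ S ∣ ≡ 2 + m → SteinerDist G S (1 + m)
      distance S ∣S∣≡2+m = steinerDist-of-connected G (¬separating-∁⇒connected G ¬sep) ∣S∣≡2+m
        where
          ¬sep : ¬ Separating G (∁ S)
          ¬sep sep = ℕ.1+n≰n (subst (4 ≤_) (∣∁S∣≡3 S ∣S∣≡2+m) (κ≥⇒separators≥ G κ≥4 (∁ S) sep))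
      S₀ : Subset (5 + m)
      S₀ = ⊤ - zero - suc zero - suc (suc zero)
      ∣S₀∣≡2+m : ∣ S₀ ∣ ≡ 2 + m
      ∣S₀∣≡2+m = ℕ.suc-injective (ℕ.suc-injective (ℕ.suc-injective
                   (∣⊤-x-y-z∣ {x = zero} {suc zero} {suc (suc zero)} (λ ()) (λ ()) (λ ()))))

  sdiam≡n∸4⇒κ≥4 : SDiam G (2 + m) (1 + m) → KappaAtLeast G 4
  sdiam≡n∸4⇒κ≥4 (_ , sdiam≤) = separators≥⇒κ≥ G (s≤s (s≤s (s≤s (s≤s z≤n)))) large
    where
      no-separating-triple : ∀ X → ∣ X ∣ ≡ 3 → ¬ Separating G X
      no-separating-triple X ∣X∣≡3 sep = ¬¬steinerDist G G-connected (∁ X) 1≤n λ (d , H , d≤) →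
        short-steiner⇒¬separating-∁ G H
          (subst (suc d ≤_) (sym (∣∁X∣≡2+m X ∣X∣≡3)) (s≤s (sdiam≤ (∁ X) (∣∁X∣≡2+m X ∣X∣≡3) d (H , d≤))))
          (subst (Separating G) (sym (∁-involutive X)) sep)

      large : ∀ S → Separating G S → 4 ≤ ∣ S ∣
      large S (a , b , a∉S , b∉S , ¬a↝b) with 4 ≤? ∣ S ∣
      ... | yes 4≤∣S∣ = 4≤∣S∣
      ... | no 4≰∣S∣ =
        let (X , S⊆X , X⊆⊤-a-b , ∣X∣≡3) = shrink m S⊆⊤-a-b (ℕ.≤-pred (ℕ.≰⇒> 4≰∣S∣)) ∣⊤-a-b∣≡3+m
        in ⊥-elim (no-separating-triple X ∣X∣≡3
             (separating-⊆ G S⊆X (a∉⊤-a-b ∘ X⊆⊤-a-b) (b∉⊤-a-b ∘ X⊆⊤-a-b) ¬a↝b))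
        where
          a≢b : a ≢ b
          a≢b refl = ¬a↝b here
          S⊆⊤-a-b : S ⊆ ⊤ - a - b
          S⊆⊤-a-b {s} s∈S = x∈p∧x≢y⇒x∈p-y (x∈p∧x≢y⇒x∈p-y ∈⊤ (λ { refl → a∉S s∈S })) (λ { refl → b∉S s∈S })
          a∉⊤-a-b : a ∉ ⊤ - a - b
          a∉⊤-a-b a∈ = proj₂ (x∈p-y⇒x∈p∧x≢y (proj₁ (x∈p-y⇒x∈p∧x≢y a∈))) refl
          b∉⊤-a-b : b ∉ ⊤ - a - b
          b∉⊤-a-b b∈ = proj₂ (x∈p-y⇒x∈p∧x≢y b∈) refl
          ∣⊤-a-b∣≡3+m : ∣ ⊤ - a - b ∣ ≡ 3 + m
          ∣⊤-a-b∣≡3+m = ℕ.suc-injective (ℕ.suc-injective (∣⊤-x-y∣ a≢b))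

  three-cuts⇒sdiam≡n∸1 : AtLeast3CutVertices G → SDiam G (2 + m) (4 + m)
  three-cuts⇒sdiam≡n∸1 (x , y , z , x≢y , x≢z , y≢z , x-cut , y-cut , z-cut) =
    (S , ∣S∣≡2+m , spanningSteinerSubgraph G G-connected S 1≤n , lower) ,
    λ _ _ _ → steinerDist≤n∸1 G G-connected 1≤n
    where
      S : Subset (5 + m)
      S = ⊤ - x - y - z
      ∣S∣≡2+m : ∣ S ∣ ≡ 2 + m
      ∣S∣≡2+m = ℕ.suc-injective (ℕ.suc-injective (ℕ.suc-injective (∣⊤-x-y-z∣ x≢y x≢z y≢z)))
      lower : ∀ k → SteinerSubgraph G S k → 4 + m ≤ k
      lower k H with element S ∣S∣≡2+m
      ... | s₀ , s₀∈S = ℕ.≤-pred (begin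
        5 + m                         ≡⟨ sym (∣⊤∣≡n (5 + m)) ⟩
        ∣ ⊤ {5 + m} ∣                 ≤⟨ p⊆q⇒∣p∣≤∣q∣ ⊤⊆U ⟩
        ∣ SteinerSubgraph.U H ∣       ≤⟨ ∣U∣≤1+k G H ⟩
        suc k                         ∎)
        where
          open ℕ.≤-Reasoning
          ∈U : ∀ {w p q} → w ≢ p → w ≢ q → p ≢ q → CutVertex G w → CutVertex G p → CutVertex G q →
            (∀ v → v ≢ w → v ≢ p → v ≢ q → v ∈ S) → w ∈ SteinerSubgraph.U H
          ∈U w≢p w≢q p≢q w-cut p-cut q-cut rest =
            three-cut-vertices⇒∈steiner G G-connected w≢p w≢q p≢q w-cut p-cut q-cut rest s₀∈S H
          ⊤⊆U : ⊤ ⊆ SteinerSubgraph.U H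
          ⊤⊆U {w} _ with w ≟ᶠ x | w ≟ᶠ y | w ≟ᶠ z
          ... | yes refl | _ | _ =
            ∈U x≢y x≢z y≢z x-cut y-cut z-cut (λ v v≢x v≢y v≢z → ∈⊤-x-y-z v≢x v≢y v≢z)
          ... | no _ | yes refl | _ =
            ∈U (x≢y ∘ sym) y≢z x≢z y-cut x-cut z-cut (λ v v≢y v≢x v≢z → ∈⊤-x-y-z v≢x v≢y v≢z)
          ... | no _ | no _ | yes refl =
            ∈U (x≢z ∘ sym) (y≢z ∘ sym) x≢y z-cut x-cut y-cut (λ v v≢z v≢x v≢y → ∈⊤-x-y-z v≢x v≢y v≢z)
          ... | no w≢x | no w≢y | no w≢z = SteinerSubgraph.S⊆U H (∈⊤-x-y-z w≢x w≢y w≢z)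

  outside-cut : ∀ {S₀} → ∣ S₀ ∣ ≡ 2 + m → SteinerDist G S₀ (4 + m) → ∀ {t} → t ∉ S₀ → CutVertex G t
  outside-cut {S₀} ∣S₀∣≡2+m distance {t} t∉S₀ with cutVertex? G t
  ... | yes t-cut = t-cut
  ... | no ¬t-cut = ⊥-elim (ℕ.1+n≰n (¬cut-outside⇒steinerDist≤n∸2 G distance (proj₂ s₀) t∉S₀ ¬t-cut))
    where
      s₀ : ∃[ s ] s ∈ S₀
      s₀ = element S₀ ∣S₀∣≡2+m

  sdiam≡n∸1⇒three-cuts : SDiam G (2 + m) (4 + m) → AtLeast3CutVertices G
  sdiam≡n∸1⇒three-cuts ((S₀ , ∣S₀∣≡2+m , distance) , _) =
    let (x , y , z , x≢y , x≢z , y≢z , x∈ , y∈ , z∈) = three-elements (∁ S₀) (∣∁S∣≡3 S₀ ∣S₀∣≡2+m)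
    in x , y , z , x≢y , x≢z , y≢z , cut x∈ , cut y∈ , cut z∈
    where
      cut : ∀ {t} → t ∈ ∁ S₀ → CutVertex G t
      cut t∈∁S₀ = outside-cut ∣S₀∣≡2+m distance (x∈∁p⇒x∉p t∈∁S₀)

proposition2 : (n : ℕ) → 5 ≤ n → (G : Graph n) → Connected G →
    (SDiam G (n ∸ 3) (n ∸ 4) ⇔ KappaAtLeast G 4)
    × (SDiam G (n ∸ 3) (n ∸ 1) ⇔ AtLeast3CutVertices G)
proposition2 (suc (suc (suc (suc (suc m))))) (s≤s (s≤s (s≤s (s≤s (s≤s z≤n))))) G G-connected =
  mk⇔ (sdiam≡n∸4⇒κ≥4 G G-connected) (κ≥4⇒sdiam≡n∸4 G G-connected) ,
  mk⇔ (sdiam≡n∸1⇒three-cuts G G-connected) (three-cuts⇒sdiam≡n∸1 G G-connected)
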